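{- Let $G$ be a connected graph and let $\{u,v\}$ be a bridge of $G$ such that neither $u$ nor $v$ is a pendant vertex. Let $G'$ be the graph obtained from $G$ by identifying the vertices $u$ and $v$ into a single vertex $w$ (i.e. contracting the edge $\{u,v\}$) and then adding a new pendant vertex $y$ adjacent to $w$. Then $F(G')>F(G)$.
   Context: All graphs are finite, simple and undirected. A pendant vertex is a vertex of degree one. A connected subgraph of a graph $G=(V,E)$ is a graph $(V',E')$ with $\emptyset\neq V'\subseteq V$, $E'\subseteq E$, every edge of $E'$ having both endpoints in $V'$, and $(V',E')$ connected; distinct pairs $(V',E')$ are counted separately. The core index $F(G)$ is the number of connected subgraphs of $G$. -}

module Defs where

open import Data.Nat using (ℕ; _<_)
open import Data.Fin using (Fin; _≟_)
open import Data.Bool using (Bool; true; false; _∧_; _∨_; not; if_then_else_)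
open import Data.List using (List; map; allFin)
open import Data.Nat.ListAction using (sum)
open import Data.Vec using (Vec; lookup)
open import Data.Product using (_×_; ∃)
open import Relation.Nullary using (¬_)
open import Relation.Nullary.Decidable using (⌊_⌋)
open import Relation.Binary.PropositionalEquality using (_≡_)
open import Function.Bundles using (_↔_)

Adj : ℕ → Set
Adj n = Fin n → Fin n → Bool

IsSimple : ∀ {n} → Adj n → Set
IsSimple {n} A = (∀ (i j : Fin n) → A i j ≡ A j i) × (∀ (i : Fin n) → A i i ≡ false)

data Reach {n : ℕ} (A : Adj n) : Fin n → Fin n → Set where
  here : ∀ {i} → Reach A i i
  step : ∀ {i j k} → A i j ≡ true → Reach A j k → Reach A i k

Connected : ∀ {n} → Adj n → Set
Connected {n} A = Fin n × (∀ (i j : Fin n) → Reach A i j)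

_==_ : ∀ {n} → Fin n → Fin n → Bool
i == j = ⌊ i ≟ j ⌋

deg : ∀ {n} → Adj n → Fin n → ℕ
deg {n} A u = sum (map (λ j → if A u j then 1 else 0) (allFin n))

deleteEdge : ∀ {n} → Adj n → Fin n → Fin n → Adj n
deleteEdge A u v i j = A i j ∧ not ((i == u ∧ j == v) ∨ (i == v ∧ j == u))

IsBridge : ∀ {n} → Adj n → Fin n → Fin n → Set
IsBridge A u v = (A u v ≡ true) × ¬ Reach (deleteEdge A u v) u v

-- G' : contract {u,v} into w (represented by the slot u), and add a new
-- pendant vertex y adjacent to w (represented by the now free slot v).
contractAddPendant : ∀ {n} → Adj n → Fin n → Fin n → Adj n
contractAddPendant A u v i j =
  if i == v then j == u
  else if j == v then i == u
  else (not (i == j) ∧ (A i j ∨ (i == u ∧ A v j) ∨ (j == u ∧ A i v)))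

-- vertex subsets and edge subsets (symmetric 0/1 matrices); these encodings are
-- canonical, so distinct pairs (V',E') are distinct values
at : ∀ {n} → Vec (Vec Bool n) n → Adj n
at E i j = lookup (lookup E i) j

-- a connected subgraph (V', E') of A; proof fields are irrelevant, so two
-- elements are equal iff their (V', E') agree
record ConnSub {n : ℕ} (A : Adj n) : Set where
  field
    V : Vec Bool n
    E : Vec (Vec Bool n) n
    .sub      : ∀ i j → at E i j ≡ true →
                  (A i j ≡ true) × (lookup V i ≡ true) × (lookup V j ≡ true)
    .symE     : ∀ i j → at E i j ≡ at E j i
    .nonempty : ∃ (λ i → lookup V i ≡ true)
    .conn     : ∀ i j → lookup V i ≡ true → lookup V j ≡ true → Reach (at E) i j

-- F(A) = k : the connected subgraphs of A are in bijection with Fin k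
CoreIndexIs : ∀ {n} → Adj n → ℕ → Set
CoreIndexIs A k = Fin k ↔ ConnSub A

module Submission where

-- We build an injection Φ from the connected subgraphs of G to those of G′ that
-- misses one of them.  A subgraph S is sorted by how it meets the bridge
-- (`Kind`): if it avoids u and v it is kept; if it is {v} it becomes {y}; if it
-- contains the bridge it is contracted; if it lies on one side of the bridge and
-- meets u or v it is contracted and the pendant edge {w,y} is added.  Since a
-- bridge lies on no triangle, u and v have no common neighbour, so every edge at
-- w remembers which of u, v it came from; this makes each case reversible
-- (`contraction-injective`) and separates the two "one-side" kinds.  The star at
-- w with leaves y, a second neighbour of u and a second neighbour of v is not in
-- the image.

open import Defs
open import Data.Nat using (ℕ; zero; suc; _<_)
open import Data.Fin using (Fin; _≟_) renaming (zero to fzero; suc to fsuc)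
open import Data.Fin.Properties using (any?; injective⇒≤; suc-injective)
open import Data.Bool using (Bool; true; false; _∧_; _∨_; not; if_then_else_)
open import Data.Bool.Properties using (∨-identityʳ; ∧-zeroʳ; ∨-comm) renaming (_≟_ to _≟ᴮ_)
import Data.List as List
open import Data.List.Properties using (map-tabulate)
open import Data.Nat.ListAction using (sum)
open import Data.Vec using (Vec; lookup; tabulate)
open import Data.Vec.Properties using (lookup∘tabulate; tabulate∘lookup; tabulate-cong)
open import Data.Product using (_×_; _,_; ∃; proj₁; proj₂)
open import Data.Sum using (_⊎_; inj₁; inj₂)
open import Data.Empty using (⊥; ⊥-elim; ⊥-elim-irr)
open import Relation.Nullary using (¬_; yes; no; Dec; ¬?; _×-dec_)
open import Relation.Binary.PropositionalEquality
open import Function using (_∘_)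
open import Function.Bundles using (_↔_; Injection)
open import Function.Properties.Inverse using (↔⇒↣; ↔-sym)

false≢true : false ≢ true
false≢true ()

∧-true⁻ : ∀ {a b} → a ∧ b ≡ true → a ≡ true × b ≡ true
∧-true⁻ {true} {true} _ = refl , refl

∧-true⁺ : ∀ {a b} → a ≡ true → b ≡ true → a ∧ b ≡ true
∧-true⁺ refl refl = refl

∨-true⁻ : ∀ {a b} → a ∨ b ≡ true → a ≡ true ⊎ b ≡ true
∨-true⁻ {true} _ = inj₁ refl
∨-true⁻ {false} {true} _ = inj₂ refl

∨-true⁺ˡ : ∀ {a b} → a ≡ true → a ∨ b ≡ true
∨-true⁺ˡ refl = refl

∨-true⁺ʳ : ∀ {a b} → b ≡ true → a ∨ b ≡ true
∨-true⁺ʳ {false} refl = refl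
∨-true⁺ʳ {true} refl = refl

not-true⁻ : ∀ {a} → not a ≡ true → a ≡ false
not-true⁻ {false} _ = refl

not-true⁺ : ∀ {a} → a ≡ false → not a ≡ true
not-true⁺ refl = refl

bool-ext : ∀ {a b} → (a ≡ true → b ≡ true) → (b ≡ true → a ≡ true) → a ≡ b
bool-ext {false} {false} _ _ = refl
bool-ext {true} {true} _ _ = refl
bool-ext {false} {true} _ g = g refl
bool-ext {true} {false} f _ = sym (f refl)

-- Equalities of Booleans are decidable, hence can be recovered from irrelevant
-- proofs; this is how we read the irrelevant fields of `ConnSub`.
recompute-≡ : {a b : Bool} → .(a ≡ b) → a ≡ b
recompute-≡ {false} {false} _ = refl
recompute-≡ {true} {true} _ = refl
recompute-≡ {false} {true} ()
recompute-≡ {true} {false} ()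

irr-false : {b : Bool} → .(b ≡ true → ⊥) → b ≡ false
irr-false {false} _ = refl
irr-false {true} f = ⊥-elim-irr (f refl)

irr-true : {b : Bool} → .(b ≡ false → ⊥) → b ≡ true
irr-true {true} _ = refl
irr-true {false} f = ⊥-elim-irr (f refl)

==-refl : ∀ {n} (x : Fin n) → (x == x) ≡ true
==-refl x with x ≟ x
... | yes _ = refl
... | no x≢x = ⊥-elim (x≢x refl)

==-false : ∀ {n} {x y : Fin n} → x ≢ y → (x == y) ≡ false
==-false {x = x} {y} x≢y with x ≟ y
... | yes x≡y = ⊥-elim (x≢y x≡y)
... | no _ = refl

==-sound : ∀ {n} {x y : Fin n} → (x == y) ≡ true → x ≡ y
==-sound {x = x} {y} e with x ≟ y
... | yes x≡y = x≡y
==-sound {x = x} {y} () | no _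

==-false⁻ : ∀ {n} {x y : Fin n} → (x == y) ≡ false → x ≢ y
==-false⁻ {x = x} e refl = false≢true (trans (sym e) (==-refl x))

Reach-trans : ∀ {n} {E : Adj n} {i j k} → Reach E i j → Reach E j k → Reach E i k
Reach-trans here q = q
Reach-trans (step e p) q = step e (Reach-trans p q)

Reach-rev : ∀ {n} {E : Adj n} → (∀ i j → E i j ≡ E j i) → ∀ {i j} → Reach E i j → Reach E j i
Reach-rev symE here = here
Reach-rev symE (step {i} {j} e p) = Reach-trans (Reach-rev symE p) (step (trans (symE j i) e) here)

Reach-map : ∀ {n} {E E′ : Adj n} (φ : Fin n → Fin n) →
  (∀ a b → E a b ≡ true → φ a ≡ φ b ⊎ E′ (φ a) (φ b) ≡ true) →
  ∀ {i j} → Reach E i j → Reach E′ (φ i) (φ j)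
Reach-map φ h here = here
Reach-map φ h (step {a} {b} e p) with h a b e
... | inj₁ φa≡φb rewrite φa≡φb = Reach-map φ h p
... | inj₂ e′ = step e′ (Reach-map φ h p)

Reach-mono : ∀ {n} {E E′ : Adj n} → (∀ a b → E a b ≡ true → E′ a b ≡ true) →
  ∀ {i j} → Reach E i j → Reach E′ i j
Reach-mono h here = here
Reach-mono h (step e p) = step (h _ _ e) (Reach-mono h p)

firstEdge : ∀ {n} {E : Adj n} {a b} → Reach E a b → a ≢ b → ∃ λ j → E a j ≡ true
firstEdge here a≢a = ⊥-elim (a≢a refl)
firstEdge (step {j = j} e _) _ = j , e

-- Connected subgraphs, presented by membership functions.  `IsConnSub A V E`
-- says that (V, E) is a connected subgraph of A; non-emptiness and connectivity
-- are irrelevant, as in `ConnSub`: they are only ever used to build such proofs.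

record IsConnSub {n} (A : Adj n) (V : Fin n → Bool) (E : Adj n) : Set where
  field
    inside    : ∀ i j → E i j ≡ true → (A i j ≡ true) × (V i ≡ true) × (V j ≡ true)
    symmetric : ∀ i j → E i j ≡ E j i
    .inhabited : ∃ λ i → V i ≡ true
    .connected : ∀ i j → V i ≡ true → V j ≡ true → Reach E i j

fromCentre : ∀ {n} {E : Adj n} {V : Fin n → Bool} (c : Fin n) → (∀ i j → E i j ≡ E j i) →
  (∀ x → V x ≡ true → Reach E c x) → ∀ i j → V i ≡ true → V j ≡ true → Reach E i j
fromCentre c symE h i j vi vj = Reach-trans (Reach-rev symE (h i vi)) (h j vj)

module _ {n : ℕ} {A : Adj n} where

  vertices : ConnSub A → Fin n → Bool
  vertices S = lookup (ConnSub.V S)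

  edges : ConnSub A → Adj n
  edges S = at (ConnSub.E S)

  isConnSub : (S : ConnSub A) → IsConnSub A (vertices S) (edges S)
  isConnSub record { sub = sb ; symE = sy ; nonempty = ne ; conn = cn } = record
    { inside = λ i j e → recompute-≡ (proj₁ (sb i j e)) , recompute-≡ (proj₁ (proj₂ (sb i j e))) ,
                         recompute-≡ (proj₂ (proj₂ (sb i j e)))
    ; symmetric = λ i j → recompute-≡ (sy i j)
    ; inhabited = ne
    ; connected = cn }

  tabulateAdj : Adj n → Vec (Vec Bool n) n
  tabulateAdj E = tabulate (λ i → tabulate (E i))

  at-tabulateAdj : ∀ E i j → at (tabulateAdj E) i j ≡ E i j
  at-tabulateAdj E i j rewrite lookup∘tabulate (λ i → tabulate (E i)) i = lookup∘tabulate (E i) j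

  toConnSub : ∀ {V E} → IsConnSub A V E → ConnSub A
  toConnSub {V} {E} record { inside = inside ; symmetric = symmetric ; inhabited = ne ; connected = cn } = record
    { V = tabulate V
    ; E = tabulateAdj E
    ; sub = λ i j e → let (a , vi , vj) = inside i j (trans (sym (at-tabulateAdj E i j)) e) in
        a , trans (lookup∘tabulate V i) vi , trans (lookup∘tabulate V j) vj
    ; symE = λ i j → trans (at-tabulateAdj E i j) (trans (symmetric i j) (sym (at-tabulateAdj E j i)))
    ; nonempty = proj₁ ne , trans (lookup∘tabulate V (proj₁ ne)) (proj₂ ne)
    ; conn = λ i j vi vj → Reach-mono (λ a b e → trans (at-tabulateAdj E a b) e)
        (cn i j (trans (sym (lookup∘tabulate V i)) vi) (trans (sym (lookup∘tabulate V j)) vj))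
    }

  ConnSub-ext : ∀ {S T : ConnSub A} → (∀ i → vertices S i ≡ vertices T i) →
    (∀ i j → edges S i j ≡ edges T i j) → S ≡ T
  ConnSub-ext {S} {T} eqV eqE = fields-equal (vec-ext eqV) (vec-ext (λ i → vec-ext (eqE i)))
    where
    vec-ext : ∀ {m} {X : Set} {xs ys : Vec X m} → (∀ i → lookup xs i ≡ lookup ys i) → xs ≡ ys
    vec-ext {xs = xs} {ys} p = trans (sym (tabulate∘lookup xs)) (trans (tabulate-cong p) (tabulate∘lookup ys))
    fields-equal : ConnSub.V S ≡ ConnSub.V T → ConnSub.E S ≡ ConnSub.E T → S ≡ T
    fields-equal refl refl = refl

  toConnSub-injective : ∀ {V V′ E E′} {P : IsConnSub A V E} {P′ : IsConnSub A V′ E′} →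
    toConnSub P ≡ toConnSub P′ → (∀ x → V x ≡ V′ x) × (∀ i j → E i j ≡ E′ i j)
  toConnSub-injective {V} {V′} {E} {E′} eq =
    (λ x → trans (sym (lookup∘tabulate V x)) (trans (cong (λ S → vertices S x) eq) (lookup∘tabulate V′ x))) ,
    (λ i j → trans (sym (at-tabulateAdj E i j)) (trans (cong (λ S → edges S i j) eq) (at-tabulateAdj E′ i j)))

count : ∀ {m} → (Fin m → Bool) → ℕ
count f = sum (List.tabulate (λ j → if f j then 1 else 0))

deg≡count : ∀ {n} (A : Adj n) x → deg A x ≡ count (A x)
deg≡count A x = cong sum (map-tabulate (λ j → j) (λ j → if A x j then 1 else 0))

count-none : ∀ {m} (f : Fin m → Bool) → (∀ j → f j ≡ false) → count f ≡ 0
count-none {zero} f none = refl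
count-none {suc m} f none rewrite none fzero = count-none (f ∘ fsuc) (none ∘ fsuc)

count-single : ∀ {m} (f : Fin m → Bool) y → f y ≡ true → (∀ j → f j ≡ true → j ≡ y) → count f ≡ 1
count-single {suc m} f fzero fy only rewrite fy =
  cong suc (count-none (f ∘ fsuc) (λ j → irr-false (λ e → fsuc≢fzero (only (fsuc j) e))))
  where
  fsuc≢fzero : ∀ {j : Fin m} → fsuc j ≢ fzero
  fsuc≢fzero ()
count-single {suc m} f (fsuc y) fy only with f fzero in e
... | true with only fzero e
...   | ()
count-single {suc m} f (fsuc y) fy only | false =
  count-single (f ∘ fsuc) y fy (λ j e → suc-injective (only (fsuc j) e))

secondNeighbour : ∀ {n} (A : Adj n) x y → deg A x ≢ 1 → A x y ≡ true →
  ∃ λ z → A x z ≡ true × z ≢ y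
secondNeighbour A x y deg≢1 axy with any? (λ z → (A x z ≟ᴮ true) ×-dec ¬? (z ≟ y))
... | yes found = found
... | no none = ⊥-elim (deg≢1 (trans (deg≡count A x) (count-single (A x) y axy onlyY)))
  where
  onlyY : ∀ j → A x j ≡ true → j ≡ y
  onlyY j axj with j ≟ y
  ... | yes j≡y = j≡y
  ... | no j≢y = ⊥-elim (none (j , axj , j≢y))

injection-missing⇒< : ∀ {k k′} {X Y : Set} → Fin k ↔ X → Fin k′ ↔ Y →
  (f : X → Y) → (∀ {a b} → f a ≡ f b → a ≡ b) → (y : Y) → (∀ x → f x ≢ y) → k < k′
injection-missing⇒< {k} {k′} X≅ Y≅ f f-inj y missed = injective⇒≤ g-inj
  where
  module X≅ = Injection (↔⇒↣ X≅)
  module Y≅⁻¹ = Injection (↔⇒↣ (↔-sym Y≅))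
  g : Fin (suc k) → Fin k′
  g fzero = Y≅⁻¹.to y
  g (fsuc i) = Y≅⁻¹.to (f (X≅.to i))
  g-inj : ∀ {i j} → g i ≡ g j → i ≡ j
  g-inj {fzero} {fzero} _ = refl
  g-inj {fzero} {fsuc j} e = ⊥-elim (missed _ (sym (Y≅⁻¹.injective e)))
  g-inj {fsuc i} {fzero} e = ⊥-elim (missed _ (Y≅⁻¹.injective e))
  g-inj {fsuc i} {fsuc j} e = cong fsuc (X≅.injective (f-inj (Y≅⁻¹.injective e)))

module BridgeContraction {n : ℕ} (A : Adj n) (symA : ∀ i j → A i j ≡ A j i)
  (loopless : ∀ i → A i i ≡ false) (u v : Fin n) (Auv : A u v ≡ true)
  (bridge : ¬ Reach (deleteEdge A u v) u v) where

  adjacent⇒≢ : ∀ {i j} → A i j ≡ true → i ≢ j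
  adjacent⇒≢ {i} e refl = false≢true (trans (sym (loopless i)) e)

  u≢v : u ≢ v
  u≢v = adjacent⇒≢ Auv

  -- A common neighbour j of u and v would give a walk u – j – v avoiding the bridge.
  -- This is what makes the contraction reversible: an edge at w comes from u or
  -- from v, never from both.
  noCommonNeighbour : ∀ j → A u j ≡ true → A v j ≡ true → ⊥
  noCommonNeighbour j auj avj = bridge (step u–j (step j–v here))
    where
    j≢v : j ≢ v
    j≢v j≡v = adjacent⇒≢ avj (sym j≡v)
    j≢u : j ≢ u
    j≢u j≡u = adjacent⇒≢ auj (sym j≡u)
    u–j : deleteEdge A u v u j ≡ true
    u–j rewrite auj | ==-refl u | ==-false j≢v | ==-false u≢v = refl
    j–v : deleteEdge A u v j v ≡ true
    j–v rewrite symA j v | avj | ==-false j≢u | ==-false j≢v = refl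

  G′ : Adj n
  G′ = contractAddPendant A u v

  Merged : Adj n → Fin n → Fin n → Set
  Merged E i j = E i j ≡ true ⊎ (i ≡ u × E v j ≡ true) ⊎ (j ≡ u × E i v ≡ true)

  merged : Adj n → Fin n → Fin n → Bool
  merged E i j = E i j ∨ (i == u ∧ E v j) ∨ (j == u ∧ E i v)

  merged⁺ : ∀ {E i j} → Merged E i j → merged E i j ≡ true
  merged⁺ (inj₁ e) = ∨-true⁺ˡ e
  merged⁺ {E} {i} {j} (inj₂ (inj₁ (refl , e))) = ∨-true⁺ʳ {E i j} (∨-true⁺ˡ (∧-true⁺ (==-refl i) e))
  merged⁺ {E} {i} {j} (inj₂ (inj₂ (refl , e))) =
    ∨-true⁺ʳ {E i j} (∨-true⁺ʳ {i == u ∧ E v j} (∧-true⁺ (==-refl j) e))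

  merged⁻ : ∀ {E i j} → merged E i j ≡ true → Merged E i j
  merged⁻ m with ∨-true⁻ m
  ... | inj₁ e = inj₁ e
  ... | inj₂ m′ with ∨-true⁻ m′
  ...   | inj₁ m″ = let (i≡u , e) = ∧-true⁻ m″ in inj₂ (inj₁ (==-sound i≡u , e))
  ...   | inj₂ m″ = let (j≡u , e) = ∧-true⁻ m″ in inj₂ (inj₂ (==-sound j≡u , e))

  Merged-mono : ∀ {E E′} → (∀ a b → E a b ≡ true → E′ a b ≡ true) → ∀ {i j} → Merged E i j → Merged E′ i j
  Merged-mono h (inj₁ e) = inj₁ (h _ _ e)
  Merged-mono h (inj₂ (inj₁ (p , e))) = inj₂ (inj₁ (p , h _ _ e))
  Merged-mono h (inj₂ (inj₂ (p , e))) = inj₂ (inj₂ (p , h _ _ e))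

  Merged-sym : ∀ {E} → (∀ a b → E a b ≡ E b a) → ∀ {i j} → Merged E i j → Merged E j i
  Merged-sym symE {i} {j} (inj₁ e) = inj₁ (trans (symE j i) e)
  Merged-sym symE {i} {j} (inj₂ (inj₁ (p , e))) = inj₂ (inj₂ (p , trans (symE j v) e))
  Merged-sym symE {i} {j} (inj₂ (inj₂ (p , e))) = inj₂ (inj₁ (p , trans (symE v i) e))

  G′-edge : ∀ {i j} → i ≢ v → j ≢ v → i ≢ j → Merged A i j → G′ i j ≡ true
  G′-edge {i} {j} i≢v j≢v i≢j m rewrite ==-false i≢v | ==-false j≢v = ∧-true⁺ (not-true⁺ (==-false i≢j)) (merged⁺ m)

  G′-wy : G′ u v ≡ true
  G′-wy rewrite ==-false u≢v | ==-refl v | ==-refl u = refl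

  G′-yw : G′ v u ≡ true
  G′-yw rewrite ==-refl v | ==-refl u = refl

  contractE : Adj n → Adj n
  contractE E i j = not (i == v) ∧ not (j == v) ∧ not (i == j) ∧ merged E i j

  record ContractedEdge (E : Adj n) (i j : Fin n) : Set where
    constructor contracted
    field
      i≢v : i ≢ v
      j≢v : j ≢ v
      i≢j : i ≢ j
      origin : Merged E i j

  contractE⁺ : ∀ {E i j} → ContractedEdge E i j → contractE E i j ≡ true
  contractE⁺ (contracted i≢v j≢v i≢j m) =
    ∧-true⁺ (not-true⁺ (==-false i≢v)) (∧-true⁺ (not-true⁺ (==-false j≢v))
      (∧-true⁺ (not-true⁺ (==-false i≢j)) (merged⁺ m)))

  contractE⁻ : ∀ {E i j} → contractE E i j ≡ true → ContractedEdge E i j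
  contractE⁻ c = let (a , c₁) = ∧-true⁻ c ; (b , c₂) = ∧-true⁻ c₁ ; (d , m) = ∧-true⁻ c₂ in
    contracted (==-false⁻ (not-true⁻ a)) (==-false⁻ (not-true⁻ b)) (==-false⁻ (not-true⁻ d)) (merged⁻ m)

  contractE-sym : ∀ {E} → (∀ a b → E a b ≡ E b a) → ∀ i j → contractE E i j ≡ contractE E j i
  contractE-sym {E} symE i j = bool-ext (flip {i} {j}) (flip {j} {i})
    where
    flip : ∀ {i j} → contractE E i j ≡ true → contractE E j i ≡ true
    flip {i} {j} c = let contracted i≢v j≢v i≢j m = contractE⁻ {E} {i} {j} c in
      contractE⁺ {E} {j} {i} (contracted j≢v i≢v (λ e → i≢j (sym e)) (Merged-sym symE m))

  contractE-at-yˡ : ∀ {E} j → contractE E v j ≡ false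
  contractE-at-yˡ j rewrite ==-refl v = refl

  contractE-at-yʳ : ∀ {E} i → contractE E i v ≡ false
  contractE-at-yʳ i rewrite ==-refl v = ∧-zeroʳ _

  contractV : (Fin n → Bool) → Fin n → Bool
  contractV V x = not (x == v) ∧ (V x ∨ x == u)

  contractV-w : ∀ V → contractV V u ≡ true
  contractV-w V = ∧-true⁺ (not-true⁺ (==-false u≢v)) (∨-true⁺ʳ {V u} (==-refl u))

  contractV-y : ∀ V → contractV V v ≡ false
  contractV-y V rewrite ==-refl v = refl

  contractV⁻ : ∀ {V x} → contractV V x ≡ true → x ≢ v × (V x ≡ true ⊎ x ≡ u)
  contractV⁻ {V} {x} c with ∧-true⁻ {not (x == v)} c
  ... | x≢v , m with ∨-true⁻ {V x} m
  ...   | inj₁ vx = ==-false⁻ (not-true⁻ x≢v) , inj₁ vx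
  ...   | inj₂ x≡u = ==-false⁻ (not-true⁻ x≢v) , inj₂ (==-sound x≡u)

  contractV-other : ∀ V {x} → x ≢ u → x ≢ v → contractV V x ≡ V x
  contractV-other V {x} x≢u x≢v rewrite ==-false x≢u | ==-false x≢v = ∨-identityʳ (V x)

  φ : Fin n → Fin n
  φ x = if x == v then u else x

  φ-v : φ v ≡ u
  φ-v rewrite ==-refl v = refl

  φ-other : ∀ {x} → x ≢ v → φ x ≡ x
  φ-other x≢v rewrite ==-false x≢v = refl

  -- If every vertex of V is reachable from a
  -- vertex s which collapses to w, then every vertex of the contraction is
  -- reachable from w: collapse the walks with φ.
  contract-reach : ∀ {V E} (s : Fin n) → (∀ a b → E a b ≡ true → A a b ≡ true) → φ s ≡ u →
    (∀ x → V x ≡ true → Reach E s x) → ∀ x → contractV V x ≡ true → Reach (contractE E) u x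
  contract-reach {V} {E} s E⊆A φs≡u reach x cx with contractV⁻ {V} {x} cx
  ... | _ , inj₂ refl = here
  ... | x≢v , inj₁ vx = subst₂ (Reach (contractE E)) φs≡u (φ-other x≢v) (Reach-map φ collapse (reach x vx))
    where
    collapse : ∀ a b → E a b ≡ true → φ a ≡ φ b ⊎ contractE E (φ a) (φ b) ≡ true
    collapse a b e with a ≟ v | b ≟ v
    ... | yes a≡v | yes b≡v = ⊥-elim (adjacent⇒≢ (E⊆A a b e) (trans a≡v (sym b≡v)))
    ... | yes a≡v | no b≢v = toW (b ≟ u)
      where
      toW : Dec (b ≡ u) → u ≡ b ⊎ contractE E u b ≡ true
      toW (yes b≡u) = inj₁ (sym b≡u)
      toW (no b≢u) = inj₂ (contractE⁺ {E} {u} {b}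
        (contracted u≢v b≢v (λ u≡b → b≢u (sym u≡b)) (inj₂ (inj₁ (refl , subst (λ z → E z b ≡ true) a≡v e)))))
    ... | no a≢v | yes b≡v = toW (a ≟ u)
      where
      toW : Dec (a ≡ u) → a ≡ u ⊎ contractE E a u ≡ true
      toW (yes a≡u) = inj₁ a≡u
      toW (no a≢u) = inj₂ (contractE⁺ {E} {a} {u}
        (contracted a≢v u≢v a≢u (inj₂ (inj₂ (refl , subst (λ z → E a z ≡ true) b≡v e)))))
    ... | no a≢v | no b≢v =
      inj₂ (contractE⁺ {E} {a} {b} (contracted a≢v b≢v (adjacent⇒≢ (E⊆A a b e)) (inj₁ e)))

  contract-inside : ∀ {V E} → (∀ a b → E a b ≡ true → (A a b ≡ true) × (V a ≡ true) × (V b ≡ true)) →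
    ∀ i j → contractE E i j ≡ true → (G′ i j ≡ true) × (contractV V i ≡ true) × (contractV V j ≡ true)
  contract-inside {V} {E} inside i j c with contractE⁻ {E} {i} {j} c
  ... | contracted i≢v j≢v i≢j m =
    G′-edge i≢v j≢v i≢j (Merged-mono (λ a b e → proj₁ (inside a b e)) m) ,
    ∧-true⁺ (not-true⁺ (==-false i≢v)) (endpointˡ m) , ∧-true⁺ (not-true⁺ (==-false j≢v)) (endpointʳ m)
    where
    endpointˡ : Merged E i j → (V i ∨ i == u) ≡ true
    endpointˡ (inj₁ e) = ∨-true⁺ˡ (proj₁ (proj₂ (inside i j e)))
    endpointˡ (inj₂ (inj₁ (refl , e))) = ∨-true⁺ʳ {V i} (==-refl i)
    endpointˡ (inj₂ (inj₂ (refl , e))) = ∨-true⁺ˡ (proj₁ (proj₂ (inside i v e)))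
    endpointʳ : Merged E i j → (V j ∨ j == u) ≡ true
    endpointʳ (inj₁ e) = ∨-true⁺ˡ (proj₂ (proj₂ (inside i j e)))
    endpointʳ (inj₂ (inj₁ (refl , e))) = ∨-true⁺ˡ (proj₂ (proj₂ (inside v j e)))
    endpointʳ (inj₂ (inj₂ (refl , e))) = ∨-true⁺ʳ {V j} (==-refl j)

  contractIsConnSub : ∀ {V E} → IsConnSub A V E → (s : Fin n) → V s ≡ true → φ s ≡ u →
    IsConnSub G′ (contractV V) (contractE E)
  contractIsConnSub {V} {E} record { inside = inside ; symmetric = symmetric ; connected = conn } s vs φs≡u =
    record
    { inside = contract-inside inside
    ; symmetric = contractE-sym symmetric
    ; inhabited = u , contractV-w V
    ; connected = fromCentre u (contractE-sym symmetric)
        (contract-reach s (λ a b e → proj₁ (inside a b e)) φs≡u (λ x vx → conn s x vs vx))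
    }

  wy : Adj n
  wy i j = (i == u ∧ j == v) ∨ (i == v ∧ j == u)

  wy⁻ : ∀ {i j} → wy i j ≡ true → (i ≡ u × j ≡ v) ⊎ (i ≡ v × j ≡ u)
  wy⁻ p with ∨-true⁻ p
  ... | inj₁ q = let (a , b) = ∧-true⁻ q in inj₁ (==-sound a , ==-sound b)
  ... | inj₂ q = let (a , b) = ∧-true⁻ q in inj₂ (==-sound a , ==-sound b)

  wy-uv : wy u v ≡ true
  wy-uv = ∨-true⁺ˡ (∧-true⁺ (==-refl u) (==-refl v))

  wy-vu : wy v u ≡ true
  wy-vu = ∨-true⁺ʳ {v == u ∧ u == v} (∧-true⁺ (==-refl v) (==-refl u))

  wy-sym : ∀ i j → wy i j ≡ wy j i
  wy-sym i j = bool-ext (flip {i} {j}) (flip {j} {i})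
    where
    flip : ∀ {i j} → wy i j ≡ true → wy j i ≡ true
    flip {i} {j} p with wy⁻ {i} {j} p
    ... | inj₁ (refl , refl) = wy-vu
    ... | inj₂ (refl , refl) = wy-uv

  pendantV : (Fin n → Bool) → Fin n → Bool
  pendantV V x = contractV V x ∨ x == v

  pendantE : Adj n → Adj n
  pendantE E i j = contractE E i j ∨ wy i j

  pendantV-w : ∀ V → pendantV V u ≡ true
  pendantV-w V = ∨-true⁺ˡ (contractV-w V)

  pendantV-y : ∀ V → pendantV V v ≡ true
  pendantV-y V = ∨-true⁺ʳ {contractV V v} (==-refl v)

  pendantIsConnSub : ∀ {V E} → IsConnSub A V E → (s : Fin n) → V s ≡ true → φ s ≡ u →
    IsConnSub G′ (pendantV V) (pendantE E)
  pendantIsConnSub {V} {E} record { inside = insideE ; symmetric = symE ; connected = conn } s vs φs≡u =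
    record
    { inside = inside
    ; symmetric = symmetric
    ; inhabited = u , pendantV-w V
    ; connected = fromCentre u symmetric (reach (λ x vx → conn s x vs vx))
    }
    where
    inside : ∀ i j → pendantE E i j ≡ true → (G′ i j ≡ true) × (pendantV V i ≡ true) × (pendantV V j ≡ true)
    inside i j e with ∨-true⁻ {contractE E i j} e
    ... | inj₁ c = let (g , ci , cj) = contract-inside insideE i j c in g , ∨-true⁺ˡ ci , ∨-true⁺ˡ cj
    ... | inj₂ p with wy⁻ {i} {j} p
    ...   | inj₁ (refl , refl) = G′-wy , pendantV-w V , pendantV-y V
    ...   | inj₂ (refl , refl) = G′-yw , pendantV-y V , pendantV-w V
    symmetric : ∀ i j → pendantE E i j ≡ pendantE E j i
    symmetric i j = cong₂ _∨_ (contractE-sym symE i j) (wy-sym i j)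
    reach : (∀ x → V x ≡ true → Reach E s x) → ∀ x → pendantV V x ≡ true → Reach (pendantE E) u x
    reach fromS x p with ∨-true⁻ {contractV V x} p
    ... | inj₁ c = Reach-mono (λ a b e → ∨-true⁺ˡ e)
      (contract-reach s (λ a b e → proj₁ (insideE a b e)) φs≡u fromS x c)
    ... | inj₂ x≡v with ==-sound x≡v
    ...   | refl = step (∨-true⁺ʳ {contractE E u v} wy-uv) here

  -- A subgraph avoiding v is unchanged: A and G′ agree away from v.
  untouchedIsConnSub : ∀ {V E} → IsConnSub A V E → V v ≡ false → IsConnSub G′ V E
  untouchedIsConnSub {V} {E} record { inside = inside ; symmetric = symmetric ; inhabited = ne ; connected = conn } vv =
    record { inside = inside′ ; symmetric = symmetric ; inhabited = ne ; connected = conn }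
    where
    ≢v : ∀ {x} → V x ≡ true → x ≢ v
    ≢v vx refl = false≢true (trans (sym vv) vx)
    inside′ : ∀ i j → E i j ≡ true → (G′ i j ≡ true) × (V i ≡ true) × (V j ≡ true)
    inside′ i j e = let (a , vi , vj) = inside i j e in G′-edge (≢v vi) (≢v vj) (adjacent⇒≢ a) (inj₁ a) , vi , vj

  yOnlyIsConnSub : IsConnSub G′ (_== v) (λ _ _ → false)
  yOnlyIsConnSub = record
    { inside = λ i j ()
    ; symmetric = λ i j → refl
    ; inhabited = v , ==-refl v
    ; connected = λ i j i≡v j≡v → subst₂ (Reach (λ _ _ → false)) (sym (==-sound i≡v)) (sym (==-sound j≡v)) here
    }

  _≐_ : Adj n → Adj n → Set
  E ≐ F = ∀ i j → E i j ≡ F i j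

  InA : Adj n → Set
  InA E = ∀ a b → E a b ≡ true → A a b ≡ true

  data Position (x : Fin n) : Set where
    atU : x ≡ u → Position x
    atV : x ≡ v → Position x
    elsewhere : x ≢ u → x ≢ v → Position x

  position : ∀ x → Position x
  position x with x ≟ u | x ≟ v
  ... | yes x≡u | _ = atU x≡u
  ... | no _ | yes x≡v = atV x≡v
  ... | no x≢u | no x≢v = elsewhere x≢u x≢v

  contractV-injective : ∀ {V W} → V u ≡ W u → V v ≡ W v → contractV V ≗ contractV W → V ≗ W
  contractV-injective {V} {W} eu ev eqC x with position x
  ... | atU refl = eu
  ... | atV refl = ev
  ... | elsewhere x≢u x≢v = trans (sym (contractV-other V x≢u x≢v)) (trans (eqC x) (contractV-other W x≢u x≢v))

  noLoop : ∀ {E} → InA E → ∀ i → E i i ≡ false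
  noLoop {E} E⊆A i with E i i in e
  ... | false = refl
  ... | true = ⊥-elim (adjacent⇒≢ (E⊆A i i e) refl)

  -- One half of the edge recovery: an edge of E reappears in F when the
  -- contractions agree.  At u and v this uses that u and v have no common neighbour.
  module Transfer {E F : Adj n} (E⊆A : InA E) (F⊆A : InA F) (eqC : contractE E ≐ contractE F) where

    carry : ∀ {i j} → i ≢ v → j ≢ v → i ≢ j → Merged E i j → Merged F i j
    carry {i} {j} i≢v j≢v i≢j m = ContractedEdge.origin
      (contractE⁻ {F} {i} {j} (trans (sym (eqC i j)) (contractE⁺ {E} {i} {j} (contracted i≢v j≢v i≢j m))))

    away : ∀ {i j} → i ≢ u → i ≢ v → j ≢ u → j ≢ v → E i j ≡ true → F i j ≡ true
    away {i} {j} i≢u i≢v j≢u j≢v e with carry i≢v j≢v (adjacent⇒≢ (E⊆A i j e)) (inj₁ e)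
    ... | inj₁ f = f
    ... | inj₂ (inj₁ (i≡u , _)) = ⊥-elim (i≢u i≡u)
    ... | inj₂ (inj₂ (j≡u , _)) = ⊥-elim (j≢u j≡u)

    fromU : ∀ {j} → j ≢ u → j ≢ v → E u j ≡ true → F u j ≡ true
    fromU {j} j≢u j≢v e with carry u≢v j≢v (adjacent⇒≢ (E⊆A u j e)) (inj₁ e)
    ... | inj₁ f = f
    ... | inj₂ (inj₁ (_ , f)) = ⊥-elim (noCommonNeighbour j (E⊆A u j e) (F⊆A v j f))
    ... | inj₂ (inj₂ (j≡u , _)) = ⊥-elim (j≢u j≡u)

    fromV : ∀ {j} → j ≢ u → j ≢ v → E v j ≡ true → F v j ≡ true
    fromV {j} j≢u j≢v e with carry {u} {j} u≢v j≢v (λ u≡j → j≢u (sym u≡j)) (inj₂ (inj₁ (refl , e)))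
    ... | inj₁ f = ⊥-elim (noCommonNeighbour j (F⊆A u j f) (E⊆A v j e))
    ... | inj₂ (inj₁ (_ , f)) = f
    ... | inj₂ (inj₂ (j≡u , _)) = ⊥-elim (j≢u j≡u)

  contractE-injective : ∀ {E F} → InA E → InA F → (∀ a b → E a b ≡ E b a) → (∀ a b → F a b ≡ F b a) →
    E u v ≡ F u v → contractE E ≐ contractE F → E ≐ F
  contractE-injective {E} {F} E⊆A F⊆A symE symF euv eqC = edge
    where
    module EF = Transfer E⊆A F⊆A eqC
    module FE = Transfer F⊆A E⊆A (λ i j → sym (eqC i j))
    flipped : ∀ {a b} → E a b ≡ F a b → E b a ≡ F b a
    flipped {a} {b} e = trans (symE b a) (trans e (symF a b))
    loop : ∀ a → E a a ≡ F a a
    loop a = trans (noLoop E⊆A a) (sym (noLoop F⊆A a))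
    rowU : ∀ {j} → j ≢ u → j ≢ v → E u j ≡ F u j
    rowU j≢u j≢v = bool-ext (EF.fromU j≢u j≢v) (FE.fromU j≢u j≢v)
    rowV : ∀ {j} → j ≢ u → j ≢ v → E v j ≡ F v j
    rowV j≢u j≢v = bool-ext (EF.fromV j≢u j≢v) (FE.fromV j≢u j≢v)
    edge : E ≐ F
    edge i j with position i | position j
    ... | atU refl | atU refl = loop u
    ... | atU refl | atV refl = euv
    ... | atV refl | atU refl = flipped euv
    ... | atV refl | atV refl = loop v
    ... | atU refl | elsewhere j≢u j≢v = rowU j≢u j≢v
    ... | atV refl | elsewhere j≢u j≢v = rowV j≢u j≢v
    ... | elsewhere i≢u i≢v | atU refl = flipped (rowU i≢u i≢v)
    ... | elsewhere i≢u i≢v | atV refl = flipped (rowV i≢u i≢v)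
    ... | elsewhere i≢u i≢v | elsewhere j≢u j≢v = bool-ext (EF.away i≢u i≢v j≢u j≢v) (FE.away i≢u i≢v j≢u j≢v)

  pendantV-forget : ∀ {V W} → pendantV V ≗ pendantV W → contractV V ≗ contractV W
  pendantV-forget {V} {W} eqP x = byCases (x ≟ v)
    where
    open ≡-Reasoning
    byCases : Dec (x ≡ v) → contractV V x ≡ contractV W x
    byCases (yes refl) = trans (contractV-y V) (sym (contractV-y W))
    byCases (no x≢v) = begin
      contractV V x           ≡⟨ sym (∨-identityʳ _) ⟩
      contractV V x ∨ false   ≡⟨ cong (contractV V x ∨_) (sym (==-false x≢v)) ⟩
      pendantV V x            ≡⟨ eqP x ⟩
      pendantV W x            ≡⟨ cong (contractV W x ∨_) (==-false x≢v) ⟩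
      contractV W x ∨ false   ≡⟨ ∨-identityʳ _ ⟩
      contractV W x           ∎

  pendantE-forget : ∀ {E F} → pendantE E ≐ pendantE F → contractE E ≐ contractE F
  pendantE-forget {E} {F} eqP i j with wy i j in e
  ... | false = begin
    contractE E i j           ≡⟨ sym (∨-identityʳ _) ⟩
    contractE E i j ∨ false   ≡⟨ cong (contractE E i j ∨_) (sym e) ⟩
    pendantE E i j            ≡⟨ eqP i j ⟩
    pendantE F i j            ≡⟨ cong (contractE F i j ∨_) e ⟩
    contractE F i j ∨ false   ≡⟨ ∨-identityʳ _ ⟩
    contractE F i j           ∎
    where open ≡-Reasoning
  ... | true with wy⁻ {i} {j} e
  ...   | inj₁ (_ , refl) = trans (contractE-at-yʳ {E} i) (sym (contractE-at-yʳ {F} i))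
  ...   | inj₂ (refl , _) = trans (contractE-at-yˡ {E} j) (sym (contractE-at-yˡ {F} j))

  edges⊆A : (S : ConnSub A) → InA (edges S)
  edges⊆A S a b e = proj₁ (IsConnSub.inside (isConnSub S) a b e)

  edge-sym : (S : ConnSub A) → ∀ a b → edges S a b ≡ edges S b a
  edge-sym S = IsConnSub.symmetric (isConnSub S)

  absent⇒noEdge : (S : ConnSub A) → ∀ {i} j → vertices S i ≡ false → edges S i j ≡ false
  absent⇒noEdge S {i} j vi with edges S i j in e
  ... | false = refl
  ... | true = ⊥-elim (false≢true (trans (sym vi) (proj₁ (proj₂ (IsConnSub.inside (isConnSub S) i j e)))))

  -- A connected subgraph containing u and v contains the bridge: otherwise its
  -- walk from u to v would avoid the bridge.  (`deleteEdge A u v` is `A` minus `wy`.)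
  bridge-used : (S : ConnSub A) → vertices S u ≡ true → vertices S v ≡ true → edges S u v ≡ true
  bridge-used S@record { conn = conn } vu vv =
    irr-true (λ noBridge → bridge (Reach-mono (avoids noBridge) (conn u v vu vv)))
    where
    avoids : edges S u v ≡ false → ∀ a b → edges S a b ≡ true → deleteEdge A u v a b ≡ true
    avoids noBridge a b e = ∧-true⁺ (edges⊆A S a b e) (not-true⁺ (notWy (wy a b) refl))
      where
      notWy : ∀ w → wy a b ≡ w → w ≡ false
      notWy false _ = refl
      notWy true p with wy⁻ {a} {b} p
      ... | inj₁ (refl , refl) = ⊥-elim (false≢true (trans (sym noBridge) e))
      ... | inj₂ (refl , refl) = ⊥-elim (false≢true (trans (sym noBridge) (trans (edge-sym S u v) e)))

  isolated-vertices : (S : ConnSub A) → vertices S v ≡ true → (∀ j → edges S v j ≡ false) →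
    ∀ x → vertices S x ≡ (x == v)
  isolated-vertices S@record { conn = conn } vv noEdge x with x ≟ v
  ... | yes refl = vv
  ... | no x≢v = irr-false (λ vx →
    let (j , e) = firstEdge (conn v x vv vx) (λ v≡x → x≢v (sym v≡x)) in false≢true (trans (sym (noEdge j)) e))

  isolated-edges : (S : ConnSub A) → vertices S v ≡ true → (∀ j → edges S v j ≡ false) →
    ∀ i j → edges S i j ≡ false
  isolated-edges S vv noEdge i j with edges S i j in e
  ... | false = refl
  ... | true = ⊥-elim (false≢true (trans (sym (noEdge j)) (subst (λ z → edges S z j ≡ true) i≡v e)))
    where
    i≡v : i ≡ v
    i≡v = ==-sound (trans (sym (isolated-vertices S vv noEdge i))
                          (proj₁ (proj₂ (IsConnSub.inside (isConnSub S) i j e))))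

  -- The five kinds of connected subgraphs S of A, according to how S meets the
  -- bridge.  The indices record whether the image of S in G′ contains w and y.
  data Kind (S : ConnSub A) : Bool → Bool → Set where
    avoids  : vertices S u ≡ false → vertices S v ≡ false → Kind S false false
    uSide   : vertices S u ≡ true → vertices S v ≡ false → Kind S true true
    vAlone  : vertices S u ≡ false → vertices S v ≡ true → (∀ j → edges S v j ≡ false) → Kind S false true
    vSide   : vertices S u ≡ false → vertices S v ≡ true → (j : Fin n) → edges S v j ≡ true → Kind S true true
    crosses : vertices S u ≡ true → vertices S v ≡ true → Kind S true false

  kind : (S : ConnSub A) → ∃ λ w∈ → ∃ λ y∈ → Kind S w∈ y∈
  kind S = byMembership (vertices S u) (vertices S v) refl refl
    where
    byMembership : ∀ a b → vertices S u ≡ a → vertices S v ≡ b → ∃ λ w∈ → ∃ λ y∈ → Kind S w∈ y∈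
    byMembership false false pu pv = _ , _ , avoids pu pv
    byMembership true false pu pv = _ , _ , uSide pu pv
    byMembership true true pu pv = _ , _ , crosses pu pv
    byMembership false true pu pv with any? (λ j → edges S v j ≟ᴮ true)
    ... | yes (j , e) = _ , _ , vSide pu pv j e
    ... | no none = _ , _ , vAlone pu pv (λ j → irr-false (λ e → none (j , e)))

  imageV : ∀ {S w∈ y∈} → Kind S w∈ y∈ → Fin n → Bool
  imageV {S} (avoids _ _) = vertices S
  imageV {S} (uSide _ _) = pendantV (vertices S)
  imageV (vAlone _ _ _) = _== v
  imageV {S} (vSide _ _ _ _) = pendantV (vertices S)
  imageV {S} (crosses _ _) = contractV (vertices S)

  imageE : ∀ {S w∈ y∈} → Kind S w∈ y∈ → Adj n
  imageE {S} (avoids _ _) = edges S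
  imageE {S} (uSide _ _) = pendantE (edges S)
  imageE (vAlone _ _ _) = λ _ _ → false
  imageE {S} (vSide _ _ _ _) = pendantE (edges S)
  imageE {S} (crosses _ _) = contractE (edges S)

  imageIsConnSub : ∀ {S w∈ y∈} (k : Kind S w∈ y∈) → IsConnSub G′ (imageV k) (imageE k)
  imageIsConnSub {S} (avoids _ vv) = untouchedIsConnSub (isConnSub S) vv
  imageIsConnSub {S} (uSide vu _) = pendantIsConnSub (isConnSub S) u vu (φ-other u≢v)
  imageIsConnSub (vAlone _ _ _) = yOnlyIsConnSub
  imageIsConnSub {S} (vSide _ vv _ _) = pendantIsConnSub (isConnSub S) v vv φ-v
  imageIsConnSub {S} (crosses vu _) = contractIsConnSub (isConnSub S) u vu (φ-other u≢v)

  image-w : ∀ {S w∈ y∈} (k : Kind S w∈ y∈) → imageV k u ≡ w∈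
  image-w (avoids vu _) = vu
  image-w {S} (uSide _ _) = pendantV-w (vertices S)
  image-w (vAlone _ _ _) = ==-false u≢v
  image-w {S} (vSide _ _ _ _) = pendantV-w (vertices S)
  image-w {S} (crosses _ _) = contractV-w (vertices S)

  image-y : ∀ {S w∈ y∈} (k : Kind S w∈ y∈) → imageV k v ≡ y∈
  image-y (avoids _ vv) = vv
  image-y {S} (uSide _ _) = pendantV-y (vertices S)
  image-y (vAlone _ _ _) = ==-refl v
  image-y {S} (vSide _ _ _ _) = pendantV-y (vertices S)
  image-y {S} (crosses _ _) = contractV-y (vertices S)

  Φ : ConnSub A → ConnSub G′
  Φ S = toConnSub (imageIsConnSub (proj₂ (proj₂ (kind S))))

  -- Subgraphs of the same kind are recovered from their
  -- images; the only two kinds with equal indices, uSide and vSide, are told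
  -- apart by the side of the bridge their edges at w come from.

  contraction-injective : ∀ {S T} → vertices S u ≡ vertices T u → vertices S v ≡ vertices T v →
    edges S u v ≡ edges T u v → contractV (vertices S) ≗ contractV (vertices T) →
    contractE (edges S) ≐ contractE (edges T) → S ≡ T
  contraction-injective {S} {T} eu ev euv eqV eqE = ConnSub-ext (contractV-injective eu ev eqV)
    (contractE-injective (edges⊆A S) (edges⊆A T) (edge-sym S) (edge-sym T) euv eqE)

  -- An edge v–j of a v-side subgraph T contracts to w–j; a u-side subgraph S can
  -- produce w–j only from u–j (then j is a common neighbour) or v–j (but v ∉ S).
  sides-differ : ∀ S T → vertices S v ≡ false → vertices T u ≡ false → ∀ j → edges T v j ≡ true →
    ¬ (contractE (edges S) ≐ contractE (edges T))
  sides-differ S T sv tu j e eqC with Transfer.carry (edges⊆A T) (edges⊆A S) (λ a b → sym (eqC a b))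
                                         u≢v j≢v (λ u≡j → j≢u (sym u≡j)) (inj₂ (inj₁ (refl , e)))
    where
    j≢v : j ≢ v
    j≢v j≡v = adjacent⇒≢ (edges⊆A T v j e) (sym j≡v)
    j≢u : j ≢ u
    j≢u refl = false≢true (trans (sym tu) (proj₂ (proj₂ (IsConnSub.inside (isConnSub T) v j e))))
  ... | inj₁ e′ = noCommonNeighbour j (edges⊆A S u j e′) (edges⊆A T v j e)
  ... | inj₂ (inj₁ (_ , e′)) = false≢true (trans (sym (absent⇒noEdge S j sv)) e′)
  ... | inj₂ (inj₂ (refl , _)) = false≢true (trans (sym tu) (proj₂ (proj₂ (IsConnSub.inside (isConnSub T) v u e))))

  same-kind : ∀ {S T w∈ y∈} (k : Kind S w∈ y∈) (l : Kind T w∈ y∈) →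
    imageV k ≗ imageV l → imageE k ≐ imageE l → S ≡ T
  same-kind (avoids _ _) (avoids _ _) eqV eqE = ConnSub-ext eqV eqE
  same-kind {S} {T} (uSide su sv) (uSide tu tv) eqV eqE =
    contraction-injective (trans su (sym tu)) (trans sv (sym tv))
      (trans (trans (edge-sym S u v) (absent⇒noEdge S u sv)) (sym (trans (edge-sym T u v) (absent⇒noEdge T u tv))))
      (pendantV-forget {vertices S} {vertices T} eqV) (pendantE-forget {edges S} {edges T} eqE)
  same-kind {S} {T} (vSide su sv _ _) (vSide tu tv _ _) eqV eqE =
    contraction-injective (trans su (sym tu)) (trans sv (sym tv))
      (trans (absent⇒noEdge S v su) (sym (absent⇒noEdge T v tu)))
      (pendantV-forget {vertices S} {vertices T} eqV) (pendantE-forget {edges S} {edges T} eqE)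
  same-kind {S} {T} (crosses su sv) (crosses tu tv) eqV eqE =
    contraction-injective (trans su (sym tu)) (trans sv (sym tv))
      (trans (bridge-used S su sv) (sym (bridge-used T tu tv))) eqV eqE
  same-kind {S} {T} (vAlone _ sv sNo) (vAlone _ tv tNo) _ _ =
    ConnSub-ext (λ x → trans (isolated-vertices S sv sNo x) (sym (isolated-vertices T tv tNo x)))
                (λ i j → trans (isolated-edges S sv sNo i j) (sym (isolated-edges T tv tNo i j)))
  same-kind {S} {T} (uSide _ sv) (vSide tu _ j e) _ eqE = ⊥-elim (sides-differ S T sv tu j e (pendantE-forget {edges S} {edges T} eqE))
  same-kind {S} {T} (vSide su _ j e) (uSide _ tv) _ eqE =
    ⊥-elim (sides-differ T S tv su j e (λ a b → sym (pendantE-forget {edges S} {edges T} eqE a b)))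

  image-injective : ∀ {S T a b a′ b′} (k : Kind S a b) (l : Kind T a′ b′) →
    toConnSub (imageIsConnSub k) ≡ toConnSub (imageIsConnSub l) → S ≡ T
  image-injective k l eq with toConnSub-injective {P = imageIsConnSub k} {P′ = imageIsConnSub l} eq
  ... | eqV , eqE with trans (sym (image-w k)) (trans (eqV u) (image-w l))
                     | trans (sym (image-y k)) (trans (eqV v) (image-y l))
  ...   | refl | refl = same-kind k l eqV eqE

  Φ-injective : ∀ {S T} → Φ S ≡ Φ T → S ≡ T
  Φ-injective {S} {T} eq with kind S | kind T
  ... | _ , _ , k | _ , _ , l = image-injective k l eq

  pendantE-at-w : ∀ {E j} → j ≢ v → pendantE E u j ≡ true → Merged E u j
  pendantE-at-w {E} {j} j≢v p with ∨-true⁻ {contractE E u j} p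
  ... | inj₁ c = ContractedEdge.origin (contractE⁻ {E} {u} {j} c)
  ... | inj₂ q with wy⁻ {u} {j} q
  ...   | inj₁ (_ , j≡v) = ⊥-elim (j≢v j≡v)
  ...   | inj₂ (u≡v , _) = ⊥-elim (u≢v u≡v)

  -- It lies outside the image of Φ:
  -- its preimage would have to contain edges at u and at v, but not the bridge.
  module Star (u′ v′ : Fin n) (Auu′ : A u u′ ≡ true) (u′≢v : u′ ≢ v)
              (Avv′ : A v v′ ≡ true) (v′≢u : v′ ≢ u) where

    u′≢u : u′ ≢ u
    u′≢u u′≡u = adjacent⇒≢ Auu′ (sym u′≡u)

    v′≢v : v′ ≢ v
    v′≢v v′≡v = adjacent⇒≢ Avv′ (sym v′≡v)

    leaf : Fin n → Bool
    leaf x = x == v ∨ x == u′ ∨ x == v′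

    leaf⁻ : ∀ {x} → leaf x ≡ true → x ≡ v ⊎ x ≡ u′ ⊎ x ≡ v′
    leaf⁻ {x} l with ∨-true⁻ {x == v} l
    ... | inj₁ p = inj₁ (==-sound p)
    ... | inj₂ l′ with ∨-true⁻ {x == u′} l′
    ...   | inj₁ p = inj₂ (inj₁ (==-sound p))
    ...   | inj₂ p = inj₂ (inj₂ (==-sound p))

    starV : Fin n → Bool
    starV x = x == u ∨ leaf x

    starE : Adj n
    starE i j = (i == u ∧ leaf j) ∨ (j == u ∧ leaf i)

    starV-centre : starV u ≡ true
    starV-centre = ∨-true⁺ˡ (==-refl u)

    starV-leaf : ∀ {x} → leaf x ≡ true → starV x ≡ true
    starV-leaf {x} l = ∨-true⁺ʳ {x == u} l

    spoke : ∀ {x} → leaf x ≡ true → G′ u x ≡ true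
    spoke {x} l with leaf⁻ {x} l
    ... | inj₁ refl = G′-wy
    ... | inj₂ (inj₁ refl) = G′-edge u≢v u′≢v (λ u≡u′ → u′≢u (sym u≡u′)) (inj₁ Auu′)
    ... | inj₂ (inj₂ refl) = G′-edge u≢v v′≢v (λ u≡v′ → v′≢u (sym u≡v′)) (inj₂ (inj₁ (refl , Avv′)))

    spoke-sym : ∀ {x} → leaf x ≡ true → G′ x u ≡ true
    spoke-sym {x} l with leaf⁻ {x} l
    ... | inj₁ refl = G′-yw
    ... | inj₂ (inj₁ refl) = G′-edge u′≢v u≢v u′≢u (inj₁ (trans (symA u′ u) Auu′))
    ... | inj₂ (inj₂ refl) = G′-edge v′≢v u≢v v′≢u (inj₂ (inj₂ (refl , trans (symA v′ v) Avv′)))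

    starIsConnSub : IsConnSub G′ starV starE
    starIsConnSub = record
      { inside = inside
      ; symmetric = λ i j → ∨-comm (i == u ∧ leaf j) (j == u ∧ leaf i)
      ; inhabited = u , starV-centre
      ; connected = fromCentre u (λ i j → ∨-comm (i == u ∧ leaf j) (j == u ∧ leaf i)) reach
      }
      where
      inside : ∀ i j → starE i j ≡ true → (G′ i j ≡ true) × (starV i ≡ true) × (starV j ≡ true)
      inside i j e with ∨-true⁻ {i == u ∧ leaf j} e
      ... | inj₁ q with ∧-true⁻ {i == u} q
      ...   | i≡u , l with ==-sound i≡u
      ...     | refl = spoke {j} l , starV-centre , starV-leaf {j} l
      inside i j e | inj₂ q with ∧-true⁻ {j == u} q
      ...   | j≡u , l with ==-sound j≡u
      ...     | refl = spoke-sym {i} l , starV-leaf {i} l , starV-centre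
      reach : ∀ x → starV x ≡ true → Reach starE u x
      reach x s with ∨-true⁻ {x == u} s
      ... | inj₁ x≡u = subst (Reach starE u) (sym (==-sound x≡u)) here
      ... | inj₂ l = step {j = x} (∨-true⁺ˡ (∧-true⁺ (==-refl u) l)) here

    star : ConnSub G′
    star = toConnSub starIsConnSub

    starE-u′ : starE u u′ ≡ true
    starE-u′ = ∨-true⁺ˡ (∧-true⁺ (==-refl u) (∨-true⁺ʳ {u′ == v} (∨-true⁺ˡ (==-refl u′))))

    starE-v′ : starE u v′ ≡ true
    starE-v′ = ∨-true⁺ˡ (∧-true⁺ (==-refl u) (∨-true⁺ʳ {v′ == v} (∨-true⁺ʳ {v′ == u′} (==-refl v′))))

    image-not-star : ∀ {S a b} (k : Kind S a b) → toConnSub (imageIsConnSub k) ≢ star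
    image-not-star {S} k eq with toConnSub-injective {P = imageIsConnSub k} {P′ = starIsConnSub} eq
    ... | eqV , eqE with trans (sym (image-w k)) (trans (eqV u) starV-centre)
                       | trans (sym (image-y k)) (trans (eqV v) (starV-leaf {v} (∨-true⁺ˡ (==-refl v))))
    ...   | refl | refl = noPreimage k eqE
      where
      noPreimage : (k : Kind S true true) → imageE k ≐ starE → ⊥
      noPreimage (uSide _ sv) eqE with pendantE-at-w {edges S} v′≢v (trans (eqE u v′) starE-v′)
      ... | inj₁ e = noCommonNeighbour v′ (edges⊆A S u v′ e) Avv′
      ... | inj₂ (inj₁ (_ , e)) = false≢true (trans (sym (absent⇒noEdge S v′ sv)) e)
      ... | inj₂ (inj₂ (v′≡u , _)) = v′≢u v′≡u
      noPreimage (vSide su _ _ _) eqE with pendantE-at-w {edges S} u′≢v (trans (eqE u u′) starE-u′)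
      ... | inj₁ e = false≢true (trans (sym (absent⇒noEdge S u′ su)) e)
      ... | inj₂ (inj₁ (_ , e)) = noCommonNeighbour u′ Auu′ (edges⊆A S v u′ e)
      ... | inj₂ (inj₂ (u′≡u , _)) = u′≢u u′≡u

    star-not-image : ∀ S → Φ S ≢ star
    star-not-image S with kind S
    ... | _ , _ , k = image-not-star k

lemma3p1 : ∀ {n : ℕ} (A : Adj n) → IsSimple A → Connected A →
             (u v : Fin n) → IsBridge A u v →
             deg A u ≢ 1 → deg A v ≢ 1 →
             (k k′ : ℕ) → CoreIndexIs A k →
             CoreIndexIs (contractAddPendant A u v) k′ → k < k′
lemma3p1 A (symA , loopless) _ u v (Auv , bridge) deg-u deg-v k k′ countG countG′ =
  injection-missing⇒< countG countG′ Φ Φ-injective star star-not-image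
  where
  open BridgeContraction A symA loopless u v Auv bridge
  u-second : ∃ λ u′ → A u u′ ≡ true × u′ ≢ v
  u-second = secondNeighbour A u v deg-u Auv
  v-second : ∃ λ v′ → A v v′ ≡ true × v′ ≢ u
  v-second = secondNeighbour A v u deg-v (trans (symA v u) Auv)
  open Star (proj₁ u-second) (proj₁ v-second) (proj₁ (proj₂ u-second)) (proj₂ (proj₂ u-second))
            (proj₁ (proj₂ v-second)) (proj₂ (proj₂ v-second))
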